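{- Let $\Gamma\vdash t:\sigma$ be derivable in system $\mathcal B$. If every element of $\mathrm{args}(\sigma)$ is inhabited, then there are a testing context $T$ and a type $\tau$ not of the form $\mathcal M\to\rho$ such that $\Gamma\vdash T\langle t\rangle:\tau$ is derivable in $\mathcal B$.
   Context: Terms: $t ::= x \mid t\,u \mid \lambda x.t \mid\ !t \mid \mathrm{der}(t) \mid t[x\backslash u]$. Testing contexts: $T ::= \langle\cdot\rangle \mid T\,s \mid (\lambda x.T)\,s$. Types $\sigma ::= \alpha \mid \mathcal M \mid \mathcal M\to\sigma$, multitypes $\mathcal M$ finite multisets of types. Environments map variables to multitypes, all but finitely many empty; $+$ pointwise multiset union; $\emptyset$ the everywhere-empty environment. System $\mathcal B$: (var) $x:[\sigma]\vdash x:\sigma$; (abs) $\Gamma,x:\mathcal M\vdash t:\sigma\Rightarrow\Gamma\vdash\lambda x.t:\mathcal M\to\sigma$; (app) $\Gamma\vdash t:\mathcal M\to\sigma$, $\Delta\vdash u:\mathcal M\Rightarrow\Gamma+\Delta\vdash tu:\sigma$; (es) $\Gamma,x:\mathcal M\vdash t:\sigma$, $\Delta\vdash u:\mathcal M\Rightarrow\Gamma+\Delta\vdash t[x\backslash u]:\sigma$; (bg) $(\Gamma_i\vdash t:\sigma_i)_{i\in I}$ ($I$ finite, possibly empty) $\Rightarrow+_i\Gamma_i\vdash !t:[\sigma_i]_{i\in I}$; (dr) $\Gamma\vdash t:[\sigma]\Rightarrow\Gamma\vdash\mathrm{der}(t):\sigma$. A type is inhabited if $\emptyset\vdash u:\sigma$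 is derivable for some term $u$. $\mathrm{args}(\mathcal M)=\mathrm{args}(\alpha)=\emptyset$, $\mathrm{args}(\mathcal M\to\sigma)=\{\mathcal M\}\cup\mathrm{args}(\sigma)$. -}

module Defs where

open import Data.Nat using (ℕ; _≟_)
open import Data.List using (List; []; _∷_; _++_)
open import Data.List.Relation.Binary.Permutation.Propositional using (_↭_)
open import Data.Product using (Σ; _×_; ∃-syntax)
open import Relation.Nullary using (¬_; yes; no)
open import Relation.Binary.PropositionalEquality using (_≡_)

Var : Set
Var = ℕ

data Term : Set where
  var  : Var → Term
  app  : Term → Term → Term
  lam  : Var → Term → Term
  bang : Term → Term
  der  : Term → Term
  es   : Term → Var → Term → Term      -- es t x u  =  t[x\u]

data TCtx : Set where
  hole  : TCtx
  appT  : TCtx → Term → TCtx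
  lamT  : Var → TCtx → Term → TCtx

plug : TCtx → Term → Term
plug hole t = t
plug (appT T s) t = app (plug T t) s
plug (lamT x T s) t = app (lam x (plug T t)) s

-- Types σ ::= α | M | M → σ ; multitypes are finite multisets, represented
-- by lists considered up to permutation (see _≈ₘ_ below).
TyVar : Set
TyVar = ℕ

data Type : Set where
  tvar : TyVar → Type
  mty  : List Type → Type
  _⇒_  : List Type → Type → Type

MType : Set
MType = List Type

mutual
  data _≈ₜ_ : Type → Type → Set where
    tvar≈ : ∀ {a} → tvar a ≈ₜ tvar a
    mty≈  : ∀ {M N} → M ≈ₘ N → mty M ≈ₜ mty N
    ⇒≈    : ∀ {M N σ τ} → M ≈ₘ N → σ ≈ₜ τ → (M ⇒ σ) ≈ₜ (N ⇒ τ)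

  data _≈ₗ_ : List Type → List Type → Set where
    []≈ : [] ≈ₗ []
    ∷≈  : ∀ {σ τ M N} → σ ≈ₜ τ → M ≈ₗ N → (σ ∷ M) ≈ₗ (τ ∷ N)

  data _≈ₘ_ : List Type → List Type → Set where
    perm≈ : ∀ {M L N} → M ↭ L → L ≈ₗ N → M ≈ₘ N

Env : Set
Env = Var → MType

∅ : Env
∅ _ = []

_⊕_ : Env → Env → Env
(Γ ⊕ Δ) x = Γ x ++ Δ x

-- Γ with x removed (so that Γ = (Γ ∖ x), x : Γ x)
_∖_ : Env → Var → Env
(Γ ∖ x) y with x ≟ y
... | yes _ = []
... | no  _ = Γ y

⟦_∶_⟧ : Var → MType → Env
⟦ x ∶ M ⟧ y with x ≟ y
... | yes _ = M
... | no  _ = []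

_≈ₑ_ : Env → Env → Set
Γ ≈ₑ Δ = ∀ x → Γ x ≈ₘ Δ x


-- System B.  Since environments/multitypes are represented concretely,
-- the judgment is closed under the multiset identification by rule 'conv'.
data _⊢_∶_ : Env → Term → Type → Set where
  ty-var : ∀ {x σ} → ⟦ x ∶ σ ∷ [] ⟧ ⊢ var x ∶ σ
  ty-abs : ∀ {Γ x t σ} → Γ ⊢ t ∶ σ → (Γ ∖ x) ⊢ lam x t ∶ (Γ x ⇒ σ)
  ty-app : ∀ {Γ Δ t u M σ} → Γ ⊢ t ∶ (M ⇒ σ) → Δ ⊢ u ∶ mty M → (Γ ⊕ Δ) ⊢ app t u ∶ σ
  ty-es  : ∀ {Γ Δ t x u σ} → Γ ⊢ t ∶ σ → Δ ⊢ u ∶ mty (Γ x) → ((Γ ∖ x) ⊕ Δ) ⊢ es t x u ∶ σ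
  ty-bg-nil  : ∀ {t} → ∅ ⊢ bang t ∶ mty []
  ty-bg-cons : ∀ {Γ Δ t σ M} → Γ ⊢ t ∶ σ → Δ ⊢ bang t ∶ mty M → (Γ ⊕ Δ) ⊢ bang t ∶ mty (σ ∷ M)
  ty-dr  : ∀ {Γ t σ} → Γ ⊢ t ∶ mty (σ ∷ []) → Γ ⊢ der t ∶ σ
  conv   : ∀ {Γ Γ' t σ σ'} → Γ ≈ₑ Γ' → σ ≈ₜ σ' → Γ ⊢ t ∶ σ → Γ' ⊢ t ∶ σ'

args : Type → List MType
args (tvar _) = []
args (mty _)  = []
args (M ⇒ σ)  = M ∷ args σ

Inhabited : Type → Set
Inhabited σ = ∃[ u ] (∅ ⊢ u ∶ σ)

NotArrow : Type → Set
NotArrow τ = ∀ M ρ → ¬ (τ ≡ (M ⇒ ρ))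

-- Apply t to inhabitants of the multitypes in args(σ), one after another: each application
-- strips one arrow off σ and, the arguments being closed, leaves the environment Γ unchanged.
-- After |args σ| steps the type is a type variable or a multitype.
module Submission where

open import Defs
open import Data.List using ([]; _∷_)
open import Data.List.Membership.Propositional using (_∈_)
open import Data.List.Relation.Unary.Any using (here; there)
open import Data.List.Properties using (++-identityʳ)
open import Data.List.Relation.Binary.Permutation.Propositional using (↭-refl)
open import Data.Product using (_×_; ∃-syntax; _,_)
open import Relation.Binary.PropositionalEquality using (_≡_; refl; cong; subst; sym)

mutual
  ≈ₜ-refl : ∀ σ → σ ≈ₜ σ
  ≈ₜ-refl (tvar a) = tvar≈
  ≈ₜ-refl (mty M) = mty≈ (≈ₘ-refl M)
  ≈ₜ-refl (M ⇒ σ) = ⇒≈ (≈ₘ-refl M) (≈ₜ-refl σ)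

  ≈ₗ-refl : ∀ M → M ≈ₗ M
  ≈ₗ-refl [] = []≈
  ≈ₗ-refl (σ ∷ M) = ∷≈ (≈ₜ-refl σ) (≈ₗ-refl M)

  ≈ₘ-refl : ∀ M → M ≈ₘ M
  ≈ₘ-refl M = perm≈ ↭-refl (≈ₗ-refl M)

⊕-identityʳ : ∀ Γ → (Γ ⊕ ∅) ≈ₑ Γ
⊕-identityʳ Γ x = subst (_≈ₘ Γ x) (sym (++-identityʳ (Γ x))) (≈ₘ-refl (Γ x))

ty-app-closed : ∀ {Γ t u M σ} → Γ ⊢ t ∶ (M ⇒ σ) → ∅ ⊢ u ∶ mty M → Γ ⊢ app t u ∶ σ
ty-app-closed {Γ} {σ = σ} ⊢t ⊢u = conv (⊕-identityʳ Γ) (≈ₜ-refl σ) (ty-app ⊢t ⊢u)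

_∘ᶜ_ : TCtx → TCtx → TCtx
hole ∘ᶜ U = U
appT T s ∘ᶜ U = appT (T ∘ᶜ U) s
lamT x T s ∘ᶜ U = lamT x (T ∘ᶜ U) s

plug-∘ᶜ : ∀ T U t → plug (T ∘ᶜ U) t ≡ plug T (plug U t)
plug-∘ᶜ hole U t = refl
plug-∘ᶜ (appT T s) U t = cong (λ r → app r s) (plug-∘ᶜ T U t)
plug-∘ᶜ (lamT x T s) U t = cong (λ r → app (lam x r) s) (plug-∘ᶜ T U t)

ArgsInhabited : Type → Set
ArgsInhabited σ = ∀ M → M ∈ args σ → Inhabited (mty M)

testing-context-to-non-arrow : ∀ σ {Γ t} → Γ ⊢ t ∶ σ → ArgsInhabited σ →
  ∃[ T ] ∃[ τ ] (NotArrow τ × (Γ ⊢ plug T t ∶ τ))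
testing-context-to-non-arrow (tvar a) ⊢t _ = hole , tvar a , (λ _ _ ()) , ⊢t
testing-context-to-non-arrow (mty N) ⊢t _ = hole , mty N , (λ _ _ ()) , ⊢t
testing-context-to-non-arrow (M ⇒ ρ) {Γ} {t} ⊢t inh
  with u , ⊢u ← inh M (here refl)
  with T , τ , τ-not-arrow , ⊢Ttu ←
    testing-context-to-non-arrow ρ (ty-app-closed ⊢t ⊢u) (λ N N∈ → inh N (there N∈))
  = T ∘ᶜ appT hole u , τ , τ-not-arrow
  , subst (λ r → Γ ⊢ r ∶ τ) (sym (plug-∘ᶜ T (appT hole u) t)) ⊢Ttu

lemmaB2 : ∀ {Γ t σ} → Γ ⊢ t ∶ σ →
    (∀ M → M ∈ args σ → Inhabited (mty M)) →
    ∃[ T ] ∃[ τ ] (NotArrow τ × (Γ ⊢ plug T t ∶ τ))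
lemmaB2 {σ = σ} = testing-context-to-non-arrow σ
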